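{- Let $\varphi$ be a formula. (1) If $\varphi$ does not contain $ite$, then $|\mathcal R^*(\varphi)|=O(|\varphi|)$, i.e. the size of the rewritten formula is linear in the size of $\varphi$. (2) If $\varphi$ contains $ite$, the size of $\mathcal R^*(\varphi)$ is, in the worst case, exponentially larger than $\varphi$.
   Context: Formulas and terms over a first-order signature: $\varphi::=\top\mid\bot\mid p(u_1,\dots,u_n)\mid\neg\varphi\mid\varphi\vee\varphi\mid X\varphi\mid\varphi U\varphi\mid Y\varphi\mid\varphi S\varphi$; $u::=c\mid x\mid f(u_1,\dots,u_n)\mid next(u)\mid ite(\varphi,u,u)\mid u@\tilde F\varphi\mid u@\tilde P\varphi$ ($c,f,p$ constant, function and predicate symbols, $x$ a variable; Boolean variables are used as atomic formulas). $|\cdot|$ denotes the size (number of symbol occurrences) of a formula or term. Abbreviations: $\wedge$ as usual, $\varphi R\psi:=\neg(\neg\varphi U\neg\psi)$, $Z\varphi:=\neg Y\neg\varphi$. The variables are partitioned into inputs and outputs; an atomic formula is an input predicate ($Pred^I$) if one of its arguments contains an input variable or a subterm $next(\cdot)$ or $\cdot@\tilde F\cdot$, and an output predicate ($Pred^O$) otherwise. Let $run,end$ be fixed Boolean variables and $state:=run\vee(Z\,run\wedge end)$. For $sgn\in\{ -,+\}$ the rewriting $\mathcal R^{sgn}$ is: $\mathcal R^-(Pred^I(u_1,\dots,u_n)):=\neg run\vee Pred^I(\mathcal R^-(u_1),\dots,\mathcal R^-(u_n))$; $\mathcal R^+(Pred^I(\bar u)):=run\wedge Pred^I(\mathcal R^+(u_1),\dots)$;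 $\mathcal R^{sgn}(Pred^O(\bar u)):=Pred^O(\mathcal R^{sgn}(u_1),\dots)$; $\mathcal R^{sgn}(\varphi_1\vee\varphi_2):=\mathcal R^{sgn}(\varphi_1)\vee\mathcal R^{sgn}(\varphi_2)$; $\mathcal R^-(\neg\varphi):=\neg\mathcal R^+(\varphi)$, $\mathcal R^+(\neg\varphi):=\neg\mathcal R^-(\varphi)$; $\mathcal R^-(X\varphi):=X(state\,R\,(\neg state\vee\mathcal R^-(\varphi)))$; $\mathcal R^+(X\varphi):=X(\neg state\,U\,(state\wedge\mathcal R^+(\varphi)))$; $\mathcal R^-(\varphi_1U\varphi_2):=(\neg state\vee\mathcal R^-(\varphi_1))\,U\,((state\wedge\mathcal R^-(\varphi_2))\vee Y\,end)$; $\mathcal R^+(\varphi_1U\varphi_2):=(\neg state\vee\mathcal R^+(\varphi_1))\,U\,(state\wedge\mathcal R^+(\varphi_2))$; $\mathcal R^{sgn}(Y\varphi):=Y(\neg run\,S\,(run\wedge\mathcal R^{sgn}(\varphi)))$; $\mathcal R^{sgn}(\varphi_1S\varphi_2):=(\neg state\vee\mathcal R^{sgn}(\varphi_1))\,S\,(state\wedge\mathcal R^{sgn}(\varphi_2))$; $\mathcal R^{sgn}(x):=x$, $\mathcal R^{sgn}(c):=c$, $\mathcal R^{sgn}(f(\bar u)):=f(\mathcal R^{sgn}(u_1),\dots)$, $\mathcal R^{sgn}(ite(\varphi,u_1,u_2)):=ite(\mathcal R^+(\varphi),\mathcal R^-(u_1),ite(\mathcal R^+(\neg\varphi),\mathcal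 R^-(u_2),def_{ite(\varphi,u_1,u_2)}))$ (with $def_{\dots}$ a fresh symbol), $\mathcal R^{sgn}(next(u)):=\mathcal R^{sgn}(u)@\tilde F(state)$, $\mathcal R^{sgn}(u@\tilde F\varphi):=\mathcal R^{sgn}(u)@\tilde F(state\wedge\mathcal R^+(\varphi))$, $\mathcal R^{sgn}(u@\tilde P\varphi):=\mathcal R^{sgn}(u)@\tilde P(state\wedge\mathcal R^+(\varphi))$. $\mathcal R(\varphi):=\mathcal R^-(\varphi)$ and $\mathcal R^*(\varphi):=state\,R\,(\neg state\vee\mathcal R(\varphi))$. -}

module Defs where

open import Data.Nat using (ℕ; zero; suc; _+_; _*_; _^_; _≤_)
open import Data.Bool using (Bool; true; false; _∨_; if_then_else_)
open import Data.List using (List; []; _∷_)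
open import Data.Product using (Σ; ∃; _×_; _,_)

mutual
  data Formula : Set where
    ⊤f ⊥f  : Formula
    atom   : ℕ → List Term → Formula
    bvar   : ℕ → Formula
    ¬f_    : Formula → Formula
    _∨f_   : Formula → Formula → Formula
    Xf     : Formula → Formula
    _Uf_   : Formula → Formula → Formula
    Yf     : Formula → Formula
    _Sf_   : Formula → Formula → Formula

  data Term : Set where
    con   : ℕ → Term
    var   : ℕ → Term
    fun   : ℕ → List Term → Term
    next  : Term → Term
    ite   : Formula → Term → Term → Term
    _atF_  : Term → Formula → Term
    _atP_  : Term → Formula → Term
    def   : Term → Term                     -- the fresh constant symbol def_u (one symbol)

_∧f_ : Formula → Formula → Formula
a ∧f b = ¬f ((¬f a) ∨f (¬f b))

_Rf_ : Formula → Formula → Formula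
a Rf b = ¬f ((¬f a) Uf (¬f b))

Zf : Formula → Formula
Zf a = ¬f (Yf (¬f a))

mutual
  size : Formula → ℕ
  size ⊤f = 1
  size ⊥f = 1
  size (atom p us) = suc (sizeL us)
  size (bvar x) = 1
  size (¬f a) = suc (size a)
  size (a ∨f b) = suc (size a + size b)
  size (Xf a) = suc (size a)
  size (a Uf b) = suc (size a + size b)
  size (Yf a) = suc (size a)
  size (a Sf b) = suc (size a + size b)

  sizeT : Term → ℕ
  sizeT (con c) = 1
  sizeT (var x) = 1
  sizeT (fun f us) = suc (sizeL us)
  sizeT (next u) = suc (sizeT u)
  sizeT (ite a u v) = suc (size a + sizeT u + sizeT v)
  sizeT (u atF a) = suc (sizeT u + size a)
  sizeT (u atP a) = suc (sizeT u + size a)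
  sizeT (def u) = 1

  sizeL : List Term → ℕ
  sizeL [] = 0
  sizeL (u ∷ us) = sizeT u + sizeL us

mutual
  IteFree : Formula → Set
  IteFree (atom p us) = IteFreeL us
  IteFree (¬f a) = IteFree a
  IteFree (a ∨f b) = IteFree a × IteFree b
  IteFree (Xf a) = IteFree a
  IteFree (a Uf b) = IteFree a × IteFree b
  IteFree (Yf a) = IteFree a
  IteFree (a Sf b) = IteFree a × IteFree b
  IteFree _ = ⊤′
    where open import Data.Unit renaming (⊤ to ⊤′)

  IteFreeT : Term → Set
  IteFreeT (fun f us) = IteFreeL us
  IteFreeT (next u) = IteFreeT u
  IteFreeT (ite a u v) = ⊥′
    where open import Data.Empty renaming (⊥ to ⊥′)
  IteFreeT (u atF a) = IteFreeT u × IteFree a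
  IteFreeT (u atP a) = IteFreeT u × IteFree a
  IteFreeT _ = ⊤′
    where open import Data.Unit renaming (⊤ to ⊤′)

  IteFreeL : List Term → Set
  IteFreeL [] = ⊤′
    where open import Data.Unit renaming (⊤ to ⊤′)
  IteFreeL (u ∷ us) = IteFreeT u × IteFreeL us

-- The rewriting, parameterised by the input/output partition of variables
-- (isIn x = true iff x is an input variable) and the fixed Boolean variables run, end.
module Rewriting (isIn : ℕ → Bool) (run end : ℕ) where

  mutual
    inF : Formula → Bool
    inF ⊤f = false
    inF ⊥f = false
    inF (atom p us) = inL us
    inF (bvar x) = isIn x
    inF (¬f a) = inF a
    inF (a ∨f b) = inF a ∨ inF b
    inF (Xf a) = inF a
    inF (a Uf b) = inF a ∨ inF b
    inF (Yf a) = inF a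
    inF (a Sf b) = inF a ∨ inF b

    inT : Term → Bool
    inT (con c) = false
    inT (var x) = isIn x
    inT (fun f us) = inL us
    inT (next u) = true
    inT (ite a u v) = inF a ∨ inT u ∨ inT v
    inT (u atF a) = true
    inT (u atP a) = inT u ∨ inF a
    inT (def u) = false

    inL : List Term → Bool
    inL [] = false
    inL (u ∷ us) = inT u ∨ inL us

  runf endf state : Formula
  runf = bvar run
  endf = bvar end
  state = runf ∨f (Zf runf ∧f endf)

  mutual
    Rm : Formula → Formula
    Rm ⊤f = ⊤f
    Rm ⊥f = ⊥f
    Rm (atom p us) = if inL us then (¬f runf) ∨f atom p (RmL us) else atom p (RmL us)
    Rm (bvar x) = if isIn x then (¬f runf) ∨f bvar x else bvar x
    Rm (¬f a) = ¬f (Rp a)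
    Rm (a ∨f b) = Rm a ∨f Rm b
    Rm (Xf a) = Xf (state Rf ((¬f state) ∨f Rm a))
    Rm (a Uf b) = ((¬f state) ∨f Rm a) Uf ((state ∧f Rm b) ∨f Yf endf)
    Rm (Yf a) = Yf ((¬f runf) Sf (runf ∧f Rm a))
    Rm (a Sf b) = ((¬f state) ∨f Rm a) Sf (state ∧f Rm b)

    Rp : Formula → Formula
    Rp ⊤f = ⊤f
    Rp ⊥f = ⊥f
    Rp (atom p us) = if inL us then runf ∧f atom p (RpL us) else atom p (RpL us)
    Rp (bvar x) = if isIn x then runf ∧f bvar x else bvar x
    Rp (¬f a) = ¬f (Rm a)
    Rp (a ∨f b) = Rp a ∨f Rp b
    Rp (Xf a) = Xf ((¬f state) Uf (state ∧f Rp a))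
    Rp (a Uf b) = ((¬f state) ∨f Rp a) Uf (state ∧f Rp b)
    Rp (Yf a) = Yf ((¬f runf) Sf (runf ∧f Rp a))
    Rp (a Sf b) = ((¬f state) ∨f Rp a) Sf (state ∧f Rp b)

    -- R⁻ on terms; note R⁺(¬φ) = ¬R⁻(φ) is inlined in the ite case.
    RmT : Term → Term
    RmT (con c) = con c
    RmT (var x) = var x
    RmT (fun f us) = fun f (RmL us)
    RmT (next u) = RmT u atF state
    RmT (ite a u v) = ite (Rp a) (RmT u) (ite (¬f (Rm a)) (RmT v) (def (ite a u v)))
    RmT (u atF a) = RmT u atF (state ∧f Rp a)
    RmT (u atP a) = RmT u atP (state ∧f Rp a)
    RmT (def u) = def u

    RpT : Term → Term
    RpT (con c) = con c
    RpT (var x) = var x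
    RpT (fun f us) = fun f (RpL us)
    RpT (next u) = RpT u atF state
    RpT (ite a u v) = ite (Rp a) (RmT u) (ite (¬f (Rm a)) (RmT v) (def (ite a u v)))
    RpT (u atF a) = RpT u atF (state ∧f Rp a)
    RpT (u atP a) = RpT u atP (state ∧f Rp a)
    RpT (def u) = def u

    RmL : List Term → List Term
    RmL [] = []
    RmL (u ∷ us) = RmT u ∷ RmL us

    RpL : List Term → List Term
    RpL [] = []
    RpL (u ∷ us) = RpT u ∷ RpL us

  R : Formula → Formula
  R = Rm

  R* : Formula → Formula
  R* a = state Rf ((¬f state) ∨f R a)

-- Every clause of the rewriting wraps the rewritten immediate subformulas and subterms, each
-- used once, in a context of at most 32 symbols; so |R(φ)| ≤ 32 |φ| by induction, and R* adds a
-- constant.  The one exception is ite, whose condition is rewritten twice (as R⁺φ and ¬R⁻φ):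
-- nesting n ite-conditions therefore doubles the size n times, while a budget that absorbs one
-- duplication per node, |R(φ)| < 64^|φ|, still bounds every formula.
module Submission where

open import Defs
open import Data.Nat using (ℕ; zero; suc; _+_; _*_; _^_; _≤_; _<_; _≤ᵇ_; z≤n; s≤s; z<s)
open import Data.Nat.Properties
open import Data.Nat.Tactic.RingSolver using (solve-∀; solve)
open import Data.Bool using (Bool; true; false; T)
open import Data.List using ([]; _∷_)
open import Data.Product using (∃; _×_; _,_; proj₁; proj₂)
open import Data.Sum using (_⊎_; inj₁; inj₂; map₁)
open import Relation.Binary.PropositionalEquality using (_≡_; refl; sym; cong; subst)

-- `s ⊑ n`: a rewritten object of size s is affordable for an input of size n.
record Budget (_⊑_ : ℕ → ℕ → Set) : Set where
  field
    ⊑-zero : 0 ⊑ 0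
    ⊑-join : ∀ {s t a b} → s ⊑ a → t ⊑ b → (s + t) ⊑ (a + b)
    ⊑-wrap : ∀ {k s t a b} → k ≤ 32 → s ⊑ a → t ⊑ b → (k + (s + t)) ⊑ suc (a + b)

  ≡-⊑ : ∀ {s s' n} → s ≡ s' → s' ⊑ n → s ⊑ n
  ≡-⊑ refl s'⊑n = s'⊑n

  ⊑-wrap₁ : ∀ {k s a} → k ≤ 32 → s ⊑ a → (k + s) ⊑ suc a
  ⊑-wrap₁ {k} {s} {a} k≤32 s⊑a = ≡-⊑ (cong (k +_) (sym (+-identityʳ s)))
    (subst (λ b → (k + (s + 0)) ⊑ suc b) (+-identityʳ a) (⊑-wrap k≤32 s⊑a ⊑-zero))

  ⊑-leaf : ∀ {k} → k ≤ 32 → k ⊑ 1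
  ⊑-leaf {k} k≤32 = ≡-⊑ (sym (+-identityʳ k)) (⊑-wrap₁ k≤32 ⊑-zero)

_≤32 : ∀ k {_ : T (k ≤ᵇ 32)} → k ≤ 32
(k ≤32) {k≤ᵇ32} = ≤ᵇ⇒≤ k 32 k≤ᵇ32

-- The law that pays for rewriting the condition of an ite twice.
record Duplicating (_⊑_ : ℕ → ℕ → Set) : Set where
  field
    ⊑-duplicate : ∀ {s s' t t' a u v} → s ⊑ a → s' ⊑ a → t ⊑ u → t' ⊑ v →
                  (4 + (s + s') + (t + t')) ⊑ suc (a + u + v)

linearBudget : Budget (λ s n → s ≤ 32 * n)
Budget.⊑-zero linearBudget = z≤n
Budget.⊑-join linearBudget {a = a} {b} s≤ t≤ =
  ≤-trans (+-mono-≤ s≤ t≤) (≤-reflexive (sym (*-distribˡ-+ 32 a b)))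
Budget.⊑-wrap linearBudget {a = a} {b} k≤32 s≤ t≤ =
  ≤-trans (+-mono-≤ k≤32 (Budget.⊑-join linearBudget {a = a} {b} s≤ t≤))
          (≤-reflexive (sym (*-distribˡ-+ 32 1 (a + b))))

m+n<o*p : ∀ {m n o p} → m < o → n < p → m + n < o * p
m+n<o*p {m} {n} {suc o} {suc p} (s≤s m≤o) (s≤s n≤p) = s≤s (begin
  m + n              ≤⟨ +-mono-≤ m≤o n≤p ⟩
  o + p              ≡⟨ +-comm o p ⟩
  p + o              ≤⟨ +-monoʳ-≤ p (m≤m*n o (suc p)) ⟩
  p + o * suc p      ∎)
  where open ≤-Reasoning

+-<-64* : ∀ {k w} M → k ≤ 62 → w < M + M → k + w < 64 * M
+-<-64* {k} {w} M@(suc _) k≤62 w<2M = begin-strict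
  k + w                  <⟨ +-monoʳ-< k w<2M ⟩
  k + (M + M)            ≤⟨ +-monoˡ-≤ (M + M) (≤-trans k≤62 (m≤m*n 62 M)) ⟩
  62 * M + (M + M)       ≡⟨ regroup M ⟩
  64 * M                 ∎
  where
    open ≤-Reasoning
    regroup : ∀ x → 62 * x + (x + x) ≡ 64 * x
    regroup = solve-∀

exponentialBudget : Budget (λ s n → s < 64 ^ n)
Budget.⊑-zero exponentialBudget = z<s
Budget.⊑-join exponentialBudget {a = a} {b} s< t< =
  <-≤-trans (m+n<o*p s< t<) (≤-reflexive (sym (^-distribˡ-+-* 64 a b)))
Budget.⊑-wrap exponentialBudget {a = a} {b} k≤32 s< t< =
  +-<-64* (64 ^ (a + b)) (≤-trans k≤32 (m≤m+n 32 30))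
          (<-≤-trans (Budget.⊑-join exponentialBudget {a = a} {b} s< t<) (m≤m+n (64 ^ (a + b)) _))

exponential-duplicating : Duplicating (λ s n → s < 64 ^ n)
Duplicating.⊑-duplicate exponential-duplicating {s} {s'} {t} {t'} {a} {u} {v} s< s'< t< t'< =
  subst (λ e → 4 + (s + s') + (t + t') < 64 ^ suc e) (sym (+-assoc a u v))
    (+-<-64* M (m≤m+n 4 58) (begin-strict
      (s + s') + (t + t')  <⟨ m+n<o*p (+-mono-< s< s'<) t+t'<Q ⟩
      (P + P) * Q          ≡⟨ *-distribʳ-+ Q P P ⟩
      P * Q + P * Q        ≡⟨ cong (λ x → x + x) (sym (^-distribˡ-+-* 64 a (u + v))) ⟩
      M + M                ∎))
  where
    open ≤-Reasoning
    P = 64 ^ a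
    Q = 64 ^ (u + v)
    M = 64 ^ (a + (u + v))
    t+t'<Q : t + t' < Q
    t+t'<Q = Budget.⊑-join exponentialBudget {a = u} {v} t< t'<

14+[x+[16+[y+2]]]≡32+[x+y] : ∀ x y → 14 + (x + (16 + (y + 2))) ≡ 32 + (x + y)
14+[x+[16+[y+2]]]≡32+[x+y] = solve-∀

14+[x+[15+y]]≡29+[x+y] : ∀ x y → 14 + (x + (15 + y)) ≡ 29 + (x + y)
14+[x+[15+y]]≡29+[x+y] = solve-∀

1+[x+11]≡12+x : ∀ x → suc (x + 11) ≡ 12 + x
1+[x+11]≡12+x = solve-∀

1+[x+[15+y]]≡16+[x+y] : ∀ x y → suc (x + (15 + y)) ≡ 16 + (x + y)
1+[x+[15+y]]≡16+[x+y] = solve-∀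

1+[x+z+[2+y+w+1]]≡4+[x+y]+[z+w] :
  ∀ x y z w → suc (x + z + suc (suc y + w + 1)) ≡ 4 + (x + y) + (z + w)
1+[x+z+[2+y+w+1]]≡4+[x+y]+[z+w] = solve-∀

1+n≤n+n : ∀ {n} → 0 < n → suc n ≤ n + n
1+n≤n+n {suc m} _ = s≤s (m≤n+m (suc m) m)

size-positive : ∀ φ → 0 < size φ
size-positive ⊤f = z<s
size-positive ⊥f = z<s
size-positive (atom _ _) = z<s
size-positive (bvar _) = z<s
size-positive (¬f _) = z<s
size-positive (_ ∨f _) = z<s
size-positive (Xf _) = z<s
size-positive (_ Uf _) = z<s
size-positive (Yf _) = z<s
size-positive (_ Sf _) = z<s

nestedIte : ℕ → Formula
nestedIte zero = ⊤f
nestedIte (suc n) = atom 0 (ite (nestedIte n) (con 0) (con 0) ∷ [])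

size-nestedIte : ∀ n → size (nestedIte n) ≡ 4 * n + 1
size-nestedIte zero = refl
size-nestedIte (suc n) rewrite size-nestedIte n = solve (n ∷ [])

module _ (isIn : ℕ → Bool) (run end : ℕ) where
  open Rewriting isIn run end

  size-R⁻-U : ∀ a b → size (Rm (a Uf b)) ≡ 32 + (size (Rm a) + size (Rm b))
  size-R⁻-U a b = 14+[x+[16+[y+2]]]≡32+[x+y] (size (Rm a)) (size (Rm b))

  size-R⁺-U : ∀ a b → size (Rp (a Uf b)) ≡ 29 + (size (Rp a) + size (Rp b))
  size-R⁺-U a b = 14+[x+[15+y]]≡29+[x+y] (size (Rp a)) (size (Rp b))

  size-R⁻-S : ∀ a b → size (Rm (a Sf b)) ≡ 29 + (size (Rm a) + size (Rm b))
  size-R⁻-S a b = 14+[x+[15+y]]≡29+[x+y] (size (Rm a)) (size (Rm b))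

  size-R⁺-S : ∀ a b → size (Rp (a Sf b)) ≡ 29 + (size (Rp a) + size (Rp b))
  size-R⁺-S a b = 14+[x+[15+y]]≡29+[x+y] (size (Rp a)) (size (Rp b))

  size-R⁻T-next : ∀ u → sizeT (RmT (next u)) ≡ 12 + sizeT (RmT u)
  size-R⁻T-next u = 1+[x+11]≡12+x (sizeT (RmT u))

  size-R⁺T-next : ∀ u → sizeT (RpT (next u)) ≡ 12 + sizeT (RpT u)
  size-R⁺T-next u = 1+[x+11]≡12+x (sizeT (RpT u))

  size-R⁻T-atF : ∀ u a → sizeT (RmT (u atF a)) ≡ 16 + (sizeT (RmT u) + size (Rp a))
  size-R⁻T-atF u a = 1+[x+[15+y]]≡16+[x+y] (sizeT (RmT u)) (size (Rp a))

  size-R⁺T-atF : ∀ u a → sizeT (RpT (u atF a)) ≡ 16 + (sizeT (RpT u) + size (Rp a))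
  size-R⁺T-atF u a = 1+[x+[15+y]]≡16+[x+y] (sizeT (RpT u)) (size (Rp a))

  size-R⁻T-atP : ∀ u a → sizeT (RmT (u atP a)) ≡ 16 + (sizeT (RmT u) + size (Rp a))
  size-R⁻T-atP u a = 1+[x+[15+y]]≡16+[x+y] (sizeT (RmT u)) (size (Rp a))

  size-R⁺T-atP : ∀ u a → sizeT (RpT (u atP a)) ≡ 16 + (sizeT (RpT u) + size (Rp a))
  size-R⁺T-atP u a = 1+[x+[15+y]]≡16+[x+y] (sizeT (RpT u)) (size (Rp a))

  -- R⁺ and R⁻ agree on ite, which rewrites its condition twice.
  size-RT-ite : ∀ a u v →
    sizeT (RmT (ite a u v)) ≡ 4 + (size (Rp a) + size (Rm a)) + (sizeT (RmT u) + sizeT (RmT v))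
  size-RT-ite a u v =
    1+[x+z+[2+y+w+1]]≡4+[x+y]+[z+w] (size (Rp a)) (size (Rm a)) (sizeT (RmT u)) (sizeT (RmT v))

  module _ {_⊑_ : ℕ → ℕ → Set} (B : Budget _⊑_) where
    open Budget B

    mutual
      size-R⁻-within : ∀ φ → IteFree φ ⊎ Duplicating _⊑_ → size (Rm φ) ⊑ size φ
      size-R⁻-within ⊤f _ = ⊑-leaf (1 ≤32)
      size-R⁻-within ⊥f _ = ⊑-leaf (1 ≤32)
      size-R⁻-within (atom p us) g with inL us
      ... | true  = ⊑-wrap₁ (4 ≤32) (size-R⁻L-within us g)
      ... | false = ⊑-wrap₁ (1 ≤32) (size-R⁻L-within us g)
      size-R⁻-within (bvar x) _ with isIn x
      ... | true  = ⊑-leaf (4 ≤32)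
      ... | false = ⊑-leaf (1 ≤32)
      size-R⁻-within (¬f a) g = ⊑-wrap₁ (1 ≤32) (size-R⁺-within a g)
      size-R⁻-within (a ∨f b) g =
        ⊑-wrap (1 ≤32) (size-R⁻-within a (map₁ proj₁ g)) (size-R⁻-within b (map₁ proj₂ g))
      size-R⁻-within (Xf a) g = ⊑-wrap₁ (29 ≤32) (size-R⁻-within a g)
      size-R⁻-within (a Uf b) g = ≡-⊑ (size-R⁻-U a b)
        (⊑-wrap (32 ≤32) (size-R⁻-within a (map₁ proj₁ g)) (size-R⁻-within b (map₁ proj₂ g)))
      size-R⁻-within (Yf a) g = ⊑-wrap₁ (9 ≤32) (size-R⁻-within a g)
      size-R⁻-within (a Sf b) g = ≡-⊑ (size-R⁻-S a b)
        (⊑-wrap (29 ≤32) (size-R⁻-within a (map₁ proj₁ g)) (size-R⁻-within b (map₁ proj₂ g)))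

      size-R⁺-within : ∀ φ → IteFree φ ⊎ Duplicating _⊑_ → size (Rp φ) ⊑ size φ
      size-R⁺-within ⊤f _ = ⊑-leaf (1 ≤32)
      size-R⁺-within ⊥f _ = ⊑-leaf (1 ≤32)
      size-R⁺-within (atom p us) g with inL us
      ... | true  = ⊑-wrap₁ (6 ≤32) (size-R⁺L-within us g)
      ... | false = ⊑-wrap₁ (1 ≤32) (size-R⁺L-within us g)
      size-R⁺-within (bvar x) _ with isIn x
      ... | true  = ⊑-leaf (6 ≤32)
      ... | false = ⊑-leaf (1 ≤32)
      size-R⁺-within (¬f a) g = ⊑-wrap₁ (1 ≤32) (size-R⁻-within a g)
      size-R⁺-within (a ∨f b) g =
        ⊑-wrap (1 ≤32) (size-R⁺-within a (map₁ proj₁ g)) (size-R⁺-within b (map₁ proj₂ g))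
      size-R⁺-within (Xf a) g = ⊑-wrap₁ (29 ≤32) (size-R⁺-within a g)
      size-R⁺-within (a Uf b) g = ≡-⊑ (size-R⁺-U a b)
        (⊑-wrap (29 ≤32) (size-R⁺-within a (map₁ proj₁ g)) (size-R⁺-within b (map₁ proj₂ g)))
      size-R⁺-within (Yf a) g = ⊑-wrap₁ (9 ≤32) (size-R⁺-within a g)
      size-R⁺-within (a Sf b) g = ≡-⊑ (size-R⁺-S a b)
        (⊑-wrap (29 ≤32) (size-R⁺-within a (map₁ proj₁ g)) (size-R⁺-within b (map₁ proj₂ g)))

      size-R⁻T-within : ∀ u → IteFreeT u ⊎ Duplicating _⊑_ → sizeT (RmT u) ⊑ sizeT u
      size-R⁻T-within (con c) _ = ⊑-leaf (1 ≤32)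
      size-R⁻T-within (var x) _ = ⊑-leaf (1 ≤32)
      size-R⁻T-within (fun f us) g = ⊑-wrap₁ (1 ≤32) (size-R⁻L-within us g)
      size-R⁻T-within (next u) g = ≡-⊑ (size-R⁻T-next u) (⊑-wrap₁ (12 ≤32) (size-R⁻T-within u g))
      size-R⁻T-within (ite a u v) (inj₁ ())
      size-R⁻T-within (ite a u v) (inj₂ dup) = ≡-⊑ (size-RT-ite a u v)
        (Duplicating.⊑-duplicate dup (size-R⁺-within a (inj₂ dup)) (size-R⁻-within a (inj₂ dup))
             (size-R⁻T-within u (inj₂ dup)) (size-R⁻T-within v (inj₂ dup)))
      size-R⁻T-within (u atF a) g = ≡-⊑ (size-R⁻T-atF u a)
        (⊑-wrap (16 ≤32) (size-R⁻T-within u (map₁ proj₁ g)) (size-R⁺-within a (map₁ proj₂ g)))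
      size-R⁻T-within (u atP a) g = ≡-⊑ (size-R⁻T-atP u a)
        (⊑-wrap (16 ≤32) (size-R⁻T-within u (map₁ proj₁ g)) (size-R⁺-within a (map₁ proj₂ g)))
      size-R⁻T-within (def u) _ = ⊑-leaf (1 ≤32)

      size-R⁺T-within : ∀ u → IteFreeT u ⊎ Duplicating _⊑_ → sizeT (RpT u) ⊑ sizeT u
      size-R⁺T-within (con c) _ = ⊑-leaf (1 ≤32)
      size-R⁺T-within (var x) _ = ⊑-leaf (1 ≤32)
      size-R⁺T-within (fun f us) g = ⊑-wrap₁ (1 ≤32) (size-R⁺L-within us g)
      size-R⁺T-within (next u) g = ≡-⊑ (size-R⁺T-next u) (⊑-wrap₁ (12 ≤32) (size-R⁺T-within u g))
      size-R⁺T-within (ite a u v) g = size-R⁻T-within (ite a u v) g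
      size-R⁺T-within (u atF a) g = ≡-⊑ (size-R⁺T-atF u a)
        (⊑-wrap (16 ≤32) (size-R⁺T-within u (map₁ proj₁ g)) (size-R⁺-within a (map₁ proj₂ g)))
      size-R⁺T-within (u atP a) g = ≡-⊑ (size-R⁺T-atP u a)
        (⊑-wrap (16 ≤32) (size-R⁺T-within u (map₁ proj₁ g)) (size-R⁺-within a (map₁ proj₂ g)))
      size-R⁺T-within (def u) _ = ⊑-leaf (1 ≤32)

      size-R⁻L-within : ∀ us → IteFreeL us ⊎ Duplicating _⊑_ → sizeL (RmL us) ⊑ sizeL us
      size-R⁻L-within [] _ = ⊑-zero
      size-R⁻L-within (u ∷ us) g =
        ⊑-join (size-R⁻T-within u (map₁ proj₁ g)) (size-R⁻L-within us (map₁ proj₂ g))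

      size-R⁺L-within : ∀ us → IteFreeL us ⊎ Duplicating _⊑_ → sizeL (RpL us) ⊑ sizeL us
      size-R⁺L-within [] _ = ⊑-zero
      size-R⁺L-within (u ∷ us) g =
        ⊑-join (size-R⁺T-within u (map₁ proj₁ g)) (size-R⁺L-within us (map₁ proj₂ g))

    size-R*-within : ∀ φ → IteFree φ ⊎ Duplicating _⊑_ → size (R* φ) ⊑ suc (size φ)
    size-R*-within φ g = ⊑-wrap₁ (28 ≤32) (size-R⁻-within φ g)

  size-R*-linear : ∀ φ → IteFree φ → size (R* φ) ≤ 64 * size φ
  size-R*-linear φ h = begin
    size (R* φ)       ≤⟨ size-R*-within linearBudget φ (inj₁ h) ⟩
    32 * suc n        ≤⟨ *-monoʳ-≤ 32 (1+n≤n+n (size-positive φ)) ⟩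
    32 * (n + n)      ≡⟨ double n ⟩
    64 * n            ∎
    where
      open ≤-Reasoning
      n = size φ
      double : ∀ x → 32 * (x + x) ≡ 64 * x
      double = solve-∀

  size-R*-exponential : ∀ φ → size (R* φ) ≤ 2 ^ (12 * size φ)
  size-R*-exponential φ = begin
    size (R* φ)       <⟨ size-R*-within exponentialBudget φ (inj₂ exponential-duplicating) ⟩
    64 ^ suc n        ≤⟨ ^-monoʳ-≤ 64 (1+n≤n+n (size-positive φ)) ⟩
    (2 ^ 6) ^ (n + n) ≡⟨ ^-*-assoc 2 6 (n + n) ⟩
    2 ^ (6 * (n + n)) ≡⟨ cong (2 ^_) (double n) ⟩
    2 ^ (12 * n)      ∎
    where
      open ≤-Reasoning
      n = size φ
      double : ∀ x → 6 * (x + x) ≡ 12 * x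
      double = solve-∀

  size-R⁻L≤size-R⁻-atom : ∀ p us → sizeL (RmL us) ≤ size (Rm (atom p us))
  size-R⁻L≤size-R⁻-atom p us with inL us
  ... | true  = m≤n+m _ 4
  ... | false = n≤1+n _

  size-R⁺L≤size-R⁺-atom : ∀ p us → sizeL (RpL us) ≤ size (Rp (atom p us))
  size-R⁺L≤size-R⁺-atom p us with inL us
  ... | true  = m≤n+m _ 6
  ... | false = n≤1+n _

  size-R⁺+size-R⁻≤size-R-ite : ∀ a u v → size (Rp a) + size (Rm a) ≤ sizeL (RmL (ite a u v ∷ []))
  size-R⁺+size-R⁻≤size-R-ite a u v = begin
    x                                       ≤⟨ m≤m+n x y ⟩
    x + y                                   ≤⟨ m≤n+m (x + y) 4 ⟩
    4 + x + y                               ≡⟨ sym (size-RT-ite a u v) ⟩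
    sizeT (RmT (ite a u v))                 ≡⟨ sym (+-identityʳ _) ⟩
    sizeL (RmL (ite a u v ∷ []))            ∎
    where
      open ≤-Reasoning
      x = size (Rp a) + size (Rm a)
      y = sizeT (RmT u) + sizeT (RmT v)

  2^n≤size-R-nestedIte : ∀ n → 2 ^ n ≤ size (Rp (nestedIte n)) × 2 ^ n ≤ size (Rm (nestedIte n))
  2^n≤size-R-nestedIte zero = s≤s z≤n , s≤s z≤n
  2^n≤size-R-nestedIte (suc n) =
    ≤-trans doubled (size-R⁺L≤size-R⁺-atom 0 us) , ≤-trans doubled (size-R⁻L≤size-R⁻-atom 0 us)
    where
      open ≤-Reasoning
      a = nestedIte n
      us = ite a (con 0) (con 0) ∷ []
      doubled : 2 ^ suc n ≤ sizeL (RmL us)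
      doubled with 2^n≤size-R-nestedIte n
      ... | 2^n≤R⁺ , 2^n≤R⁻ = begin
        2 ^ n + (2 ^ n + 0)     ≡⟨ cong (2 ^ n +_) (+-identityʳ (2 ^ n)) ⟩
        2 ^ n + 2 ^ n           ≤⟨ +-mono-≤ 2^n≤R⁺ 2^n≤R⁻ ⟩
        size (Rp a) + size (Rm a) ≤⟨ size-R⁺+size-R⁻≤size-R-ite a (con 0) (con 0) ⟩
        sizeL (RmL us)          ∎

  2^n≤size-R*-nestedIte : ∀ n → 2 ^ n ≤ size (R* (nestedIte n))
  2^n≤size-R*-nestedIte n = ≤-trans (proj₂ (2^n≤size-R-nestedIte n)) (m≤n+m _ 28)

theorem5p6 : (∃ λ (C : ℕ) → (isIn : ℕ → Bool) (run end : ℕ) (φ : Formula) →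
    IteFree φ → size (Rewriting.R* isIn run end φ) ≤ C * size φ)
    ×
    ((isIn : ℕ → Bool) (run end : ℕ) →
    ∃ λ (fam : ℕ → Formula) → ∃ λ (a : ℕ) → ∃ λ (b : ℕ) → (n : ℕ) →
    (size (fam n) ≤ a * n + b) × (2 ^ n ≤ size (Rewriting.R* isIn run end (fam n))))
    ×
    (∃ λ (C : ℕ) → (isIn : ℕ → Bool) (run end : ℕ) (φ : Formula) →
    size (Rewriting.R* isIn run end φ) ≤ 2 ^ (C * size φ))
theorem5p6 =
  (64 , size-R*-linear) ,
  (λ isIn run end → nestedIte , 4 , 1 , λ n →
     ≤-reflexive (size-nestedIte n) , 2^n≤size-R*-nestedIte isIn run end n) ,
  (12 , size-R*-exponential)
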